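{- Let $M$ be a square matrix over a field with rows and columns indexed by a finite set $V$, and let $X \subseteq V$ be such that $M[X]$ is non-singular. Then \[ P_{\langle \delta \rangle}(M, z) = P_{\langle \delta \rangle}(M \ast X, z). \] In particular, if $M$ is invertible, then \[ P_{\langle \delta \rangle}(M, z) = P_{\langle \delta \rangle}(M \ast V, z) = P_{\langle \delta \rangle}(M^{ -1}, z). \]
   Context: For a square matrix $M$ over a field with rows and columns indexed by a finite set $V$, and $A \subseteq V$, $M[A]$ denotes the principal submatrix of $M$ on $A$ and $A^c = V \setminus A$. The partial-$\langle\delta\rangle$ polynomial of $M$ is \[ P_{\langle \delta \rangle}(M, z) = \sum_{A \subseteq V} z^{\operatorname{rank}(M[A]) + \operatorname{rank}(M[A^c])} \] (with $P_{\langle \delta \rangle}(M,z)=1$ for the empty $0\times 0$ matrix). For $X \subseteq V$ with $M[X]$ non-singular, the pivot $M \ast X$ is defined as follows: write $M = \begin{pmatrix} P & Q \\ R & S \end{pmatrix}$ with $P = M[X]$ (rows/columns ordered with $X$ first); then \[ M \ast X = \begin{pmatrix} P^{ -1} & -P^{ -1}Q \\ RP^{ -1} & S - RP^{ -1}Q \end{pmatrix}. \] In particular $M \ast V = M^{ -1}$ when $M$ is invertible. -}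

module Defs where

open import Level using (Level; _⊔_) renaming (suc to lsuc)
open import Data.Nat using (ℕ; zero; suc)
import Data.Nat as ℕ
open import Data.Bool using (Bool; true; false; if_then_else_)
open import Data.Fin using (Fin; zero; suc; _≟_)
open import Data.Fin.Subset using (Subset; _∈_; ∁)
open import Data.Vec using ([]; _∷_; lookup)
open import Data.List using (List; []; _∷_; map; _++_)
open import Data.Product using (Σ; _×_; _,_)
open import Relation.Nullary using (¬_; yes; no)
open import Relation.Nullary.Decidable using (⌊_⌋)
open import Relation.Binary.PropositionalEquality using (_≡_)
open import Algebra.Bundles using (CommutativeRing)

record Field (c ℓ : Level) : Set (lsuc (c ⊔ ℓ)) where
  field
    commutativeRing : CommutativeRing c ℓ
  open CommutativeRing commutativeRing public
  field
    0#≉1#   : ¬ (0# ≈ 1#)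
    inverse : ∀ x → ¬ (x ≈ 0#) → Σ Carrier (λ y → x * y ≈ 1#)

allSubsets : (n : ℕ) → List (Subset n)
allSubsets zero    = [] ∷ []
allSubsets (suc n) = map (true ∷_) (allSubsets n) ++ map (false ∷_) (allSubsets n)

countL : ∀ {a} {A : Set a} → (A → Bool) → List A → ℕ
countL p []       = 0
countL p (x ∷ xs) = if p x then suc (countL p xs) else countL p xs

-- Coefficient of z^k in the partial-⟨δ⟩ polynomial
--   Σ_{A ⊆ V} z^(ρ A + ρ (V∖A)),
-- where ρ A is the rank of the principal submatrix M[A].
-- (A polynomial in z is identified with its coefficient sequence.)
pDeltaCoeff : {n : ℕ} → (Subset n → ℕ) → ℕ → ℕ
pDeltaCoeff {n} ρ k = countL (λ A → ⌊ ρ A ℕ.+ ρ (∁ A) ℕ.≟ k ⌋) (allSubsets n)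

module MatrixDefs {c ℓ : Level} (𝔽 : Field c ℓ) where
  open Field 𝔽 using (Carrier; _≈_; _+_; _*_; -_; _-_; 0#; 1#)

  Matrix : ℕ → Set c
  Matrix n = Fin n → Fin n → Carrier

  sumF : {n : ℕ} → (Fin n → Carrier) → Carrier
  sumF {zero}  f = 0#
  sumF {suc n} f = f zero + sumF (λ k → f (suc k))

  sumOver : {n : ℕ} → Subset n → (Fin n → Carrier) → Carrier
  sumOver X f = sumF (λ k → if lookup X k then f k else 0#)

  δ : {n : ℕ} → Fin n → Fin n → Carrier
  δ i j = if ⌊ i ≟ j ⌋ then 1# else 0#

  -- N restricted to X × X is a two-sided inverse of the principal submatrix M[X]
  -- (so M[X] is non-singular).
  IsInverseOn : {n : ℕ} → Matrix n → Subset n → Matrix n → Set ℓ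
  IsInverseOn M X N = ∀ i j → i ∈ X → j ∈ X →
      (sumOver X (λ k → N i k * M k j) ≈ δ i j)
    × (sumOver X (λ k → M i k * N k j) ≈ δ i j)

  IsInverse : {n : ℕ} → Matrix n → Matrix n → Set ℓ
  IsInverse M N = ∀ i j →
      (sumF (λ k → N i k * M k j) ≈ δ i j)
    × (sumF (λ k → M i k * N k j) ≈ δ i j)

  -- The pivot M * X, where N is the inverse P⁻¹ of P = M[X]:
  --   [ P⁻¹     -P⁻¹Q       ]
  --   [ RP⁻¹    S - RP⁻¹Q   ]
  pivot : {n : ℕ} → Matrix n → Subset n → Matrix n → Matrix n
  pivot M X N i j with lookup X i | lookup X j
  ... | true  | true  = N i j
  ... | true  | false = - sumOver X (λ k → N i k * M k j)
  ... | false | true  = sumOver X (λ k → M i k * N k j)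
  ... | false | false = M i j - sumOver X (λ k → M i k * sumOver X (λ l → N k l * M l j))

  IndependentCols : {n r : ℕ} → Matrix n → Subset n → (Fin r → Fin n) → Set (c ⊔ ℓ)
  IndependentCols {n} {r} M A js =
    (coef : Fin r → Carrier) →
    (∀ i → i ∈ A → sumF (λ t → M i (js t) * coef t) ≈ 0#) →
    ∀ t → coef t ≈ 0#

  ColumnChoice : {n : ℕ} → Subset n → ℕ → Set
  ColumnChoice {n} A r =
    Σ (Fin r → Fin n) (λ js → (∀ t → js t ∈ A) × (∀ s t → js s ≡ js t → s ≡ t))

  IsRank : {n : ℕ} → Matrix n → Subset n → ℕ → Set (c ⊔ ℓ)
  IsRank M A r =
      Σ (ColumnChoice A r) (λ { (js , _) → IndependentCols M A js })
    × (∀ (ch : ColumnChoice A (suc r)) → ¬ IndependentCols M A (Data.Product.proj₁ ch))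

  RankFunction : {n : ℕ} → Matrix n → (Subset n → ℕ) → Set (c ⊔ ℓ)
  RankFunction M ρ = ∀ A → IsRank M A (ρ A)

-- The pivot M * X is characterised by an exchange law: y = M x iff M * X sends the vector that is
-- y on X and x off X to the vector that is x on X and y off X. Hence x ↦ (M x on X, x off X)
-- embeds the kernel of M[A Δ X] linearly into the kernel of (M * X)[A], and symmetrically, so
-- the two principal submatrices have the same nullity: rank (M * X)[A] + |A Δ X| = rank M[A Δ X] + |A|.
-- Adding this for A and V ∖ A gives rank (M * X)[A] + rank (M * X)[V ∖ A] = rank M[A Δ X] +
-- rank M[V ∖ (A Δ X)], and A ↦ A Δ X permutes the subsets of V. For invertible M, M * V = M⁻¹.
--
-- Equality in the field need not be decidable, so the rank-nullity bounds are proved by Gaussian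
-- elimination inside the double-negation monad; being inequalities in ℕ, they are stable.

module Submission where

open import Defs
open import Level using (Level; _⊔_)
open import Data.Nat using (ℕ)
open import Data.Fin.Subset using (Subset; ⊤)
open import Data.Product using (_×_; _,_)
open import Relation.Binary.PropositionalEquality using (_≡_)
import Relation.Binary.PropositionalEquality as ≡

module Combinatorics where

  open import Data.Nat as ℕ using (zero; suc; _+_; _≤_; _≟_)
  import Data.Nat.Properties as ℕ
  open import Algebra.Properties.CommutativeSemigroup ℕ.+-commutativeSemigroup using (interchange)
  open import Data.Bool using (Bool; true; false; _xor_)
  open import Data.Bool.Properties using (not-distribˡ-xor; xor-assoc; xor-same; xor-identityʳ)
  open import Data.Fin using (Fin; zero; suc)
  import Data.Fin.Properties as Fin
  open import Data.Fin.Subset using (∁; ∣_∣; _∈_; _∪_; _∩_; ⁅_⁆; ⊥)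
  open import Data.Fin.Subset.Properties using (∣∁p∣≡n∸∣p∣; ∣p∣≤n; ∣⁅x⁆∣≡1; ∣⊥∣≡0; ∣p∣≤∣x∷p∣; x∈⁅x⁆; x∈p∪q⁺)
  open import Data.Sum using (inj₁; inj₂)
  open import Data.Vec using ([]; _∷_; zipWith; here; there)
  open import Data.List using (List; []; _∷_; map; _++_)
  open import Function using (_∘_)
  open import Relation.Nullary using (¬_)
  open import Relation.Nullary.Decidable using (⌊_⌋)
  open import Relation.Binary.PropositionalEquality using (refl; sym; trans; cong; cong₂; subst; module ≡-Reasoning)

  infixl 6 _Δ_
  _Δ_ : ∀ {n} → Subset n → Subset n → Subset n
  p Δ q = zipWith _xor_ p q

  Δ-involutive : ∀ {n} (p q : Subset n) → (p Δ q) Δ q ≡ p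
  Δ-involutive []      []      = refl
  Δ-involutive (x ∷ p) (y ∷ q) = cong₂ _∷_ (trans (xor-assoc x y y) (trans (cong (x xor_) (xor-same y)) (xor-identityʳ x)))
                                           (Δ-involutive p q)

  ∁-Δ : ∀ {n} (p q : Subset n) → ∁ p Δ q ≡ ∁ (p Δ q)
  ∁-Δ []      []      = refl
  ∁-Δ (x ∷ p) (y ∷ q) = cong₂ _∷_ (sym (not-distribˡ-xor x y)) (∁-Δ p q)

  ∣p∣+∣∁p∣≡n : ∀ {n} (p : Subset n) → ∣ p ∣ + ∣ ∁ p ∣ ≡ n
  ∣p∣+∣∁p∣≡n {n} p = trans (cong (∣ p ∣ +_) (∣∁p∣≡n∸∣p∣ p)) (ℕ.m+[n∸m]≡n (∣p∣≤n p))

  module _ {a} {A : Set a} where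

    countL-++ : ∀ (p : A → Bool) xs ys → countL p (xs ++ ys) ≡ countL p xs + countL p ys
    countL-++ p []       ys = refl
    countL-++ p (x ∷ xs) ys with p x
    ... | true  = cong suc (countL-++ p xs ys)
    ... | false = countL-++ p xs ys

    countL-map : ∀ {b} {B : Set b} (p : B → Bool) (f : A → B) xs → countL p (map f xs) ≡ countL (p ∘ f) xs
    countL-map p f []       = refl
    countL-map p f (x ∷ xs) with p (f x)
    ... | true  = cong suc (countL-map p f xs)
    ... | false = countL-map p f xs

    countL-cong : ∀ {p q : A → Bool} → (∀ x → p x ≡ q x) → ∀ xs → countL p xs ≡ countL q xs
    countL-cong         p≗q []       = refl
    countL-cong {p} {q} p≗q (x ∷ xs) rewrite p≗q x with q x
    ... | true  = cong suc (countL-cong p≗q xs)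
    ... | false = countL-cong p≗q xs

  countL-allSubsets-suc : ∀ {n} (p : Subset (suc n) → Bool) →
    countL p (allSubsets (suc n)) ≡ countL (p ∘ (true ∷_)) (allSubsets n) + countL (p ∘ (false ∷_)) (allSubsets n)
  countL-allSubsets-suc {n} p = trans (countL-++ p (map (true ∷_) S) _)
    (cong₂ _+_ (countL-map p (true ∷_) S) (countL-map p (false ∷_) S))
    where
    S : List (Subset n)
    S = allSubsets n

  countL-Δ : ∀ {n} (q : Subset n) (p : Subset n → Bool) →
    countL (p ∘ (_Δ q)) (allSubsets n) ≡ countL p (allSubsets n)
  countL-Δ []      p = refl
  countL-Δ {suc n} (y ∷ q) p = begin
    countL (p ∘ (_Δ (y ∷ q))) (allSubsets (suc n))
      ≡⟨ countL-allSubsets-suc (p ∘ (_Δ (y ∷ q))) ⟩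
    countL (p ∘ ((true xor y) ∷_) ∘ (_Δ q)) S + countL (p ∘ ((false xor y) ∷_) ∘ (_Δ q)) S
      ≡⟨ cong₂ _+_ (countL-Δ q (p ∘ ((true xor y) ∷_))) (countL-Δ q (p ∘ ((false xor y) ∷_))) ⟩
    countL (p ∘ ((true xor y) ∷_)) S + countL (p ∘ ((false xor y) ∷_)) S
      ≡⟨ swap y ⟩
    countL (p ∘ (true ∷_)) S + countL (p ∘ (false ∷_)) S
      ≡⟨ countL-allSubsets-suc p ⟨
    countL p (allSubsets (suc n)) ∎
    where
    open ≡-Reasoning
    S : List (Subset n)
    S = allSubsets n
    swap : ∀ y → countL (p ∘ ((true xor y) ∷_)) S + countL (p ∘ ((false xor y) ∷_)) S
               ≡ countL (p ∘ (true ∷_)) S + countL (p ∘ (false ∷_)) S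
    swap true  = ℕ.+-comm (countL (p ∘ (false ∷_)) S) _
    swap false = refl

  pDeltaCoeff-Δ : ∀ {n} (ρ ρ' : Subset n → ℕ) (X : Subset n) →
    (∀ A → ρ' A + ∣ A Δ X ∣ ≡ ρ (A Δ X) + ∣ A ∣) → ∀ k → pDeltaCoeff ρ' k ≡ pDeltaCoeff ρ k
  pDeltaCoeff-Δ {n} ρ ρ' X nullity k = trans
    (countL-cong (λ A → cong (λ m → ⌊ m ≟ k ⌋) (pairSum A)) (allSubsets n))
    (countL-Δ X (λ B → ⌊ ρ B + ρ (∁ B) ≟ k ⌋))
    where
    open ≡-Reasoning
    pairSum : ∀ A → ρ' A + ρ' (∁ A) ≡ ρ (A Δ X) + ρ (∁ (A Δ X))
    pairSum A = ℕ.+-cancelʳ-≡ n _ _ (begin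
      (ρ' A + ρ' (∁ A)) + n
        ≡⟨ cong (ρ' A + ρ' (∁ A) +_) (∣p∣+∣∁p∣≡n (A Δ X)) ⟨
      (ρ' A + ρ' (∁ A)) + (∣ A Δ X ∣ + ∣ ∁ (A Δ X) ∣)
        ≡⟨ interchange (ρ' A) _ _ _ ⟩
      (ρ' A + ∣ A Δ X ∣) + (ρ' (∁ A) + ∣ ∁ (A Δ X) ∣)
        ≡⟨ cong₂ _+_ (nullity A) (subst (λ B → ρ' (∁ A) + ∣ B ∣ ≡ ρ B + ∣ ∁ A ∣) (∁-Δ A X) (nullity (∁ A))) ⟩
      (ρ (A Δ X) + ∣ A ∣) + (ρ (∁ (A Δ X)) + ∣ ∁ A ∣)
        ≡⟨ interchange (ρ (A Δ X)) _ _ _ ⟩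
      (ρ (A Δ X) + ρ (∁ (A Δ X))) + (∣ A ∣ + ∣ ∁ A ∣)
        ≡⟨ cong (ρ (A Δ X) + ρ (∁ (A Δ X)) +_) (∣p∣+∣∁p∣≡n A) ⟩
      (ρ (A Δ X) + ρ (∁ (A Δ X))) + n ∎)

  enum : ∀ {n} (p : Subset n) → Fin ∣ p ∣ → Fin n
  enum (true  ∷ p) zero    = zero
  enum (true  ∷ p) (suc t) = suc (enum p t)
  enum (false ∷ p) t       = suc (enum p t)

  enum-∈ : ∀ {n} (p : Subset n) t → enum p t ∈ p
  enum-∈ (true  ∷ p) zero    = here
  enum-∈ (true  ∷ p) (suc t) = there (enum-∈ p t)
  enum-∈ (false ∷ p) t       = there (enum-∈ p t)

  enum-injective : ∀ {n} (p : Subset n) {s t} → enum p s ≡ enum p t → s ≡ t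
  enum-injective (true  ∷ p) {zero}  {zero}  eq = refl
  enum-injective (true  ∷ p) {suc s} {suc t} eq = cong suc (enum-injective p (Fin.suc-injective eq))
  enum-injective (false ∷ p)                 eq = enum-injective p (Fin.suc-injective eq)

  image : ∀ {r n} → (Fin r → Fin n) → Subset n
  image {zero}  js = ⊥
  image {suc r} js = ⁅ js zero ⁆ ∪ image (js ∘ suc)

  ∈-image : ∀ {r n} (js : Fin r → Fin n) t → js t ∈ image js
  ∈-image js zero    = x∈p∪q⁺ (inj₁ (x∈⁅x⁆ (js zero)))
  ∈-image js (suc t) = x∈p∪q⁺ (inj₂ (∈-image (js ∘ suc) t))

  ∣p∪q∣≤∣p∣+∣q∣ : ∀ {n} (p q : Subset n) → ∣ p ∪ q ∣ ≤ ∣ p ∣ + ∣ q ∣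
  ∣p∪q∣≤∣p∣+∣q∣ []          []          = ℕ.z≤n
  ∣p∪q∣≤∣p∣+∣q∣ (true  ∷ p) (y     ∷ q) = ℕ.s≤s (ℕ.≤-trans (∣p∪q∣≤∣p∣+∣q∣ p q) (ℕ.+-monoʳ-≤ ∣ p ∣ (∣p∣≤∣x∷p∣ y q)))
  ∣p∪q∣≤∣p∣+∣q∣ (false ∷ p) (true  ∷ q) = ℕ.≤-trans (ℕ.s≤s (∣p∪q∣≤∣p∣+∣q∣ p q)) (ℕ.≤-reflexive (sym (ℕ.+-suc ∣ p ∣ ∣ q ∣)))
  ∣p∪q∣≤∣p∣+∣q∣ (false ∷ p) (false ∷ q) = ∣p∪q∣≤∣p∣+∣q∣ p q

  ∣image∣≤ : ∀ {r n} (js : Fin r → Fin n) → ∣ image js ∣ ≤ r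
  ∣image∣≤ {zero}  {n} js = ℕ.≤-reflexive (∣⊥∣≡0 n)
  ∣image∣≤ {suc r}     js = ℕ.≤-trans (∣p∪q∣≤∣p∣+∣q∣ ⁅ js zero ⁆ (image (js ∘ suc)))
    (ℕ.≤-trans (ℕ.≤-reflexive (cong (_+ ∣ image (js ∘ suc) ∣) (∣⁅x⁆∣≡1 (js zero)))) (ℕ.s≤s (∣image∣≤ (js ∘ suc))))

  ∣p∣≤∣p∩∁q∣+∣q∣ : ∀ {n} (p q : Subset n) → ∣ p ∣ ≤ ∣ p ∩ ∁ q ∣ + ∣ q ∣
  ∣p∣≤∣p∩∁q∣+∣q∣ []          []          = ℕ.z≤n
  ∣p∣≤∣p∩∁q∣+∣q∣ (true  ∷ p) (true  ∷ q) = ℕ.≤-trans (ℕ.s≤s (∣p∣≤∣p∩∁q∣+∣q∣ p q)) (ℕ.≤-reflexive (sym (ℕ.+-suc _ ∣ q ∣)))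
  ∣p∣≤∣p∩∁q∣+∣q∣ (true  ∷ p) (false ∷ q) = ℕ.s≤s (∣p∣≤∣p∩∁q∣+∣q∣ p q)
  ∣p∣≤∣p∩∁q∣+∣q∣ (false ∷ p) (true  ∷ q) = ℕ.≤-trans (∣p∣≤∣p∩∁q∣+∣q∣ p q) (ℕ.+-monoʳ-≤ ∣ p ∩ ∁ q ∣ (ℕ.n≤1+n ∣ q ∣))
  ∣p∣≤∣p∩∁q∣+∣q∣ (false ∷ p) (false ∷ q) = ∣p∣≤∣p∩∁q∣+∣q∣ p q

  +-≤-transfer : ∀ {a b p r r'} → a ≤ p + r → p + r' ≤ b → a + r' ≤ b + r
  +-≤-transfer {a} {b} {p} {r} {r'} a≤p+r p+r'≤b = begin
    a + r'          ≤⟨ ℕ.+-monoˡ-≤ r' a≤p+r ⟩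
    p + r + r'      ≡⟨ ℕ.+-assoc p r r' ⟩
    p + (r + r')    ≡⟨ cong (p +_) (ℕ.+-comm r r') ⟩
    p + (r' + r)    ≡⟨ ℕ.+-assoc p r' r ⟨
    p + r' + r      ≤⟨ ℕ.+-monoˡ-≤ r p+r'≤b ⟩
    b + r           ∎
    where open ℕ.≤-Reasoning

  ¬¬-∀-Fin : ∀ {a m} {Q : Fin m → Set a} → (∀ i → ¬ ¬ Q i) → ¬ ¬ (∀ i → Q i)
  ¬¬-∀-Fin {m = zero}  ¬¬Q k = k λ ()
  ¬¬-∀-Fin {m = suc m} ¬¬Q k = ¬¬Q zero λ q₀ → ¬¬-∀-Fin (¬¬Q ∘ suc) λ q⁺ → k λ { zero → q₀ ; (suc i) → q⁺ i }

module LinearAlgebra {c ℓ : Level} (𝔽 : Field c ℓ) where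

  open import Data.Nat as ℕ using (zero; suc; _≤_; _<_; s≤s; _≤?_)
  import Data.Nat.Properties as ℕ
  open import Data.Bool using (Bool; true; false; if_then_else_; _xor_; not)
  open import Data.Bool.Properties using (not-injective)
  open import Data.Fin as Fin using (Fin; zero; suc; punchIn; punchOut; _↑ˡ_; _↑ʳ_; splitAt; join)
  import Data.Fin.Properties as Fin
  open import Data.Fin.Subset using (∣_∣; _∈_; _∩_; ∁; ⊤) renaming (⊥ to ∅)
  open import Data.Fin.Subset.Properties using (x∈p∩q⁻; x∈∁p⇒x∉p)
  open import Data.Vec using ([]; _∷_; lookup)
  import Data.Vec.Properties as Vec
  open import Data.Vec.Functional as Vector using (Vector; tail; removeAt; insertAt; _++_)
  import Data.Vec.Functional.Properties as Vector
  open import Data.Product using (Σ-syntax; ∃-syntax; proj₁; proj₂)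
  open import Data.Sum using (_⊎_; inj₁; inj₂; [_,_])
  open import Function using (_∘_; const)
  open import Relation.Nullary using (¬_; yes; no; contradiction)
  open import Relation.Nullary.Decidable using (¬¬-excluded-middle; decidable-stable)
  open import Relation.Binary.PropositionalEquality using (_≢_)

  open Combinatorics
    using (_Δ_; Δ-involutive; pDeltaCoeff-Δ; enum; enum-∈; enum-injective; image; ∈-image; ∣image∣≤;
           ∣p∣≤∣p∩∁q∣+∣q∣; +-≤-transfer; ¬¬-∀-Fin)

  open Field 𝔽 hiding (zero)
  open MatrixDefs 𝔽
  open import Relation.Binary.Reasoning.Setoid setoid
  open import Algebra.Properties.Ring ring
    using (-‿distribˡ-*; -‿distribʳ-*; -0#≈0#; -‿involutive; -‿+-comm; +-inverseʳ-unique; x[y-z]≈xy-xz; [y-z]x≈yx-zx)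
  open import Algebra.Properties.CommutativeSemigroup *-commutativeSemigroup using () renaming (x∙yz≈y∙xz to x*yz≈y*xz)
  open import Algebra.Properties.CommutativeSemigroup +-commutativeSemigroup using () renaming (x∙yz≈xz∙y to x+yz≈xz+y)
  open import Algebra.Properties.Semiring.Sum semiring
    using (sum; sum-cong-≋; sum-replicate-zero; sum-remove; ∑-distrib-+; ∑-comm; *-distribˡ-sum; *-distribʳ-sum)

  1#≉0# : 1# ≉ 0#
  1#≉0# = 0#≉1# ∘ sym

  nonzero-cancelˡ : ∀ {x y} → x ≉ 0# → x * y ≈ 0# → y ≈ 0#
  nonzero-cancelˡ {x} {y} x≉0 xy≈0 with inverse x x≉0
  ... | α , xα≈1 = begin
    y             ≈⟨ *-identityˡ y ⟨
    1# * y        ≈⟨ *-congʳ (trans (sym xα≈1) (*-comm x α)) ⟩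
    α * x * y     ≈⟨ *-assoc α x y ⟩
    α * (x * y)   ≈⟨ *-congˡ xy≈0 ⟩
    α * 0#        ≈⟨ zeroʳ α ⟩
    0#            ∎

  sumF≡sum : ∀ {m} (f : Vector Carrier m) → sumF f ≡ sum f
  sumF≡sum {zero}  f = ≡.refl
  sumF≡sum {suc m} f = ≡.cong (f zero +_) (sumF≡sum (tail f))

  IsZero : ∀ {m} → Vector Carrier m → Set ℓ
  IsZero v = ∀ i → v i ≈ 0#

  sum-zero : ∀ {m} {f : Vector Carrier m} → IsZero f → sum f ≈ 0#
  sum-zero {m} f≈0 = trans (sum-cong-≋ f≈0) (sum-replicate-zero m)

  sum-neg : ∀ {m} (f : Vector Carrier m) → sum (λ k → - f k) ≈ - sum f
  sum-neg {zero}  f = sym -0#≈0#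
  sum-neg {suc m} f = trans (+-congˡ (sum-neg (tail f))) (-‿+-comm (f zero) (sum (tail f)))

  sum-minus-scaled : ∀ {m} (f g : Vector Carrier m) w → sum (λ k → f k - w * g k) ≈ sum f - w * sum g
  sum-minus-scaled f g w = begin
    sum (λ k → f k - w * g k)         ≈⟨ ∑-distrib-+ f (λ k → - (w * g k)) ⟩
    sum f + sum (λ k → - (w * g k))   ≈⟨ +-congˡ (sum-neg (λ k → w * g k)) ⟩
    sum f - sum (λ k → w * g k)       ≈⟨ +-congˡ (-‿cong (*-distribˡ-sum w g)) ⟨
    sum f - w * sum g                 ∎

  sum-pick : ∀ {m} (f : Vector Carrier m) j → (∀ k → k ≢ j → f k ≈ 0#) → sum f ≈ f j
  sum-pick {suc m} f j vanish = begin
    sum f                       ≈⟨ sum-remove {i = j} f ⟩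
    f j + sum (removeAt f j)    ≈⟨ +-congˡ (sum-zero λ s → vanish (punchIn j s) (Fin.punchInᵢ≢i j s)) ⟩
    f j + 0#                    ≈⟨ +-identityʳ (f j) ⟩
    f j                         ∎

  sum-↑ : ∀ {p r} (f : Vector Carrier (p ℕ.+ r)) → sum f ≈ sum (f ∘ (_↑ˡ r)) + sum (f ∘ (p ↑ʳ_))
  sum-↑ {zero}  f = sym (+-identityˡ (sum f))
  sum-↑ {suc p} f = trans (+-congˡ (sum-↑ {p} (tail f))) (sym (+-assoc (f zero) _ _))

  -- Linear independence and Gaussian elimination

  combination : ∀ {p m} → (Fin p → Vector Carrier m) → Vector Carrier p → Vector Carrier m
  combination {p} u a i = sum {p} (λ t → u t i * a t)

  Independent : ∀ {p m} → (Fin p → Vector Carrier m) → Set (c ⊔ ℓ)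
  Independent u = ∀ a → IsZero (combination u a) → IsZero a

  Dependent : ∀ {p m} → (Fin p → Vector Carrier m) → Set (c ⊔ ℓ)
  Dependent {p} u = Σ[ a ∈ Vector Carrier p ] IsZero (combination u a) × ∃[ t ] a t ≉ 0#

  ¬¬-zero⊎nonzero : ∀ {p} (a : Vector Carrier p) → ¬ ¬ (IsZero a ⊎ ∃[ t ] a t ≉ 0#)
  ¬¬-zero⊎nonzero {zero}  a k = k (inj₁ λ ())
  ¬¬-zero⊎nonzero {suc p} a k = ¬¬-excluded-middle λ where
    (no a₀≉0)  → k (inj₂ (zero , a₀≉0))
    (yes a₀≈0) → ¬¬-zero⊎nonzero (tail a) λ where
      (inj₁ a⁺≈0)      → k (inj₁ λ { zero → a₀≈0 ; (suc t) → a⁺≈0 t })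
      (inj₂ (t , a≉0)) → k (inj₂ (suc t , a≉0))

  zero-head-relation : ∀ {p m} (u : Fin p → Vector Carrier (suc m)) → (∀ t → u t zero ≈ 0#) →
    ∀ a → IsZero (combination (tail ∘ u) a) → IsZero (combination u a)
  zero-head-relation u heads≈0 a rel zero    = sum-zero λ t → trans (*-congʳ (heads≈0 t)) (zeroˡ (a t))
  zero-head-relation u heads≈0 a rel (suc i) = rel i

  IsZero-removeAt : ∀ {p} {a : Vector Carrier (suc p)} t₀ → a t₀ ≈ 0# → IsZero (removeAt a t₀) → IsZero a
  IsZero-removeAt {a = a} t₀ aₜ₀≈0 rest≈0 t with t₀ Fin.≟ t
  ... | yes ≡.refl = aₜ₀≈0
  ... | no  t₀≢t   = ≡.subst (λ t → a t ≈ 0#) (Fin.punchIn-punchOut t₀≢t) (rest≈0 (punchOut t₀≢t))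

  IsZero-↑ : ∀ {p r} (a : Vector Carrier (p ℕ.+ r)) → IsZero (a ∘ (_↑ˡ r)) → IsZero (a ∘ (p ↑ʳ_)) → IsZero a
  IsZero-↑ {p} {r} a left≈0 right≈0 t =
    ≡.subst (λ t → a t ≈ 0#) (Fin.join-splitAt p r t) ([_,_] {C = λ s → a (join p r s) ≈ 0#} left≈0 right≈0 (splitAt p t))

  module Elimination {p m} (u : Fin (suc p) → Vector Carrier (suc m)) (t₀ : Fin (suc p))
                     {α : Carrier} (pivot⁻¹ : u t₀ zero * α ≈ 1#) where

    others : Fin p → Vector Carrier (suc m)
    others = removeAt u t₀

    reduced : Fin p → Vector Carrier m
    reduced s i = others s (suc i) - u t₀ (suc i) * (α * others s zero)

    cancel : ∀ y → u t₀ zero * (α * y) ≈ y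
    cancel y = trans (sym (*-assoc _ α y)) (trans (*-congʳ pivot⁻¹) (*-identityˡ y))

    combination-remove : ∀ a i → combination u a i ≈ u t₀ i * a t₀ + combination others (removeAt a t₀) i
    combination-remove a i = sum-remove {i = t₀} (λ t → u t i * a t)

    combination-reduced : ∀ b i →
      combination reduced b i ≈ combination others b (suc i) - u t₀ (suc i) * (α * combination others b zero)
    combination-reduced b i = begin
      sum (λ s → (others s (suc i) - w * (α * others s zero)) * b s)
        ≈⟨ sum-cong-≋ (λ s → expand (others s (suc i)) (others s zero) (b s)) ⟩
      sum (λ s → others s (suc i) * b s - w * (α * (others s zero * b s)))
        ≈⟨ sum-minus-scaled (λ s → others s (suc i) * b s) (λ s → α * (others s zero * b s)) w ⟩
      combination others b (suc i) - w * sum (λ s → α * (others s zero * b s))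
        ≈⟨ +-congˡ (-‿cong (*-congˡ (*-distribˡ-sum α (λ s → others s zero * b s)))) ⟨
      combination others b (suc i) - w * (α * combination others b zero) ∎
      where
      w : Carrier
      w = u t₀ (suc i)
      expand : ∀ x y b → (x - w * (α * y)) * b ≈ x * b - w * (α * (y * b))
      expand x y b = begin
        (x - w * (α * y)) * b        ≈⟨ distribʳ b x _ ⟩
        x * b + - (w * (α * y)) * b  ≈⟨ +-congˡ (-‿distribˡ-* _ b) ⟨
        x * b - w * (α * y) * b      ≈⟨ +-congˡ (-‿cong (trans (*-assoc w _ b) (*-congˡ (*-assoc α y b)))) ⟩
        x * b - w * (α * (y * b))    ∎

    combination-others-zero : ∀ a → IsZero (combination u a) →
      α * combination others (removeAt a t₀) zero ≈ - a t₀
    combination-others-zero a rel = begin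
      α * combination others (removeAt a t₀) zero ≈⟨ *-congˡ (+-inverseʳ-unique _ _ (trans (sym (combination-remove a zero)) (rel zero))) ⟩
      α * - (u t₀ zero * a t₀)                    ≈⟨ -‿distribʳ-* α _ ⟨
      - (α * (u t₀ zero * a t₀))                  ≈⟨ -‿cong (trans (x*yz≈y*xz α _ _) (cancel (a t₀))) ⟩
      - a t₀                                      ∎

    reduce-relation : ∀ a → IsZero (combination u a) → IsZero (combination reduced (removeAt a t₀))
    reduce-relation a rel i = begin
      combination reduced a⁻ i                                          ≈⟨ combination-reduced a⁻ i ⟩
      combination others a⁻ (suc i) - w * (α * combination others a⁻ zero) ≈⟨ +-congˡ (-‿cong (*-congˡ (combination-others-zero a rel))) ⟩
      combination others a⁻ (suc i) - w * - a t₀                        ≈⟨ +-congˡ (trans (-‿cong (sym (-‿distribʳ-* w (a t₀)))) (-‿involutive _)) ⟩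
      combination others a⁻ (suc i) + w * a t₀                          ≈⟨ +-comm _ _ ⟩
      w * a t₀ + combination others a⁻ (suc i)                          ≈⟨ combination-remove a (suc i) ⟨
      combination u a (suc i)                                           ≈⟨ rel (suc i) ⟩
      0#                                                                ∎
      where
      a⁻ : Vector Carrier p
      a⁻ = removeAt a t₀
      w : Carrier
      w = u t₀ (suc i)

    lift : Vector Carrier p → Vector Carrier (suc p)
    lift b = insertAt b t₀ (- (α * combination others b zero))

    lift-relation : ∀ b → IsZero (combination reduced b) → IsZero (combination u (lift b))
    lift-relation b rel i = begin
      combination u (lift b) i                        ≈⟨ combination-remove (lift b) i ⟩
      u t₀ i * lift b t₀ + combination others (removeAt (lift b) t₀) i
        ≈⟨ +-cong (*-congˡ (reflexive (Vector.insertAt-lookup b t₀ _)))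
                  (sum-cong-≋ λ s → *-congˡ (reflexive (Vector.removeAt-insertAt b t₀ _ s))) ⟩
      u t₀ i * - (α * h₀) + combination others b i    ≈⟨ +-congʳ (sym (-‿distribʳ-* _ _)) ⟩
      - (u t₀ i * (α * h₀)) + combination others b i  ≈⟨ +-comm _ _ ⟩
      combination others b i - u t₀ i * (α * h₀)      ≈⟨ at i ⟩
      0#                                              ∎
      where
      h₀ : Carrier
      h₀ = combination others b zero
      at : ∀ i → combination others b i - u t₀ i * (α * h₀) ≈ 0#
      at zero    = trans (+-congˡ (-‿cong (cancel h₀))) (-‿inverseʳ h₀)
      at (suc i) = trans (sym (combination-reduced b i)) (rel i)

    independent⇒reduced : Independent u → Independent reduced
    independent⇒reduced ind b rel s =
      trans (sym (reflexive (Vector.insertAt-punchIn b t₀ _ s))) (ind (lift b) (lift-relation b rel) (punchIn t₀ s))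

    reduced⇒independent : Independent reduced → Independent u
    reduced⇒independent ind a rel = IsZero-removeAt t₀ aₜ₀≈0 rest≈0
      where
      rest≈0 : IsZero (removeAt a t₀)
      rest≈0 = ind (removeAt a t₀) (reduce-relation a rel)
      aₜ₀≈0 : a t₀ ≈ 0#
      aₜ₀≈0 = begin
        a t₀                                         ≈⟨ -‿involutive (a t₀) ⟨
        - - a t₀                                     ≈⟨ -‿cong (combination-others-zero a rel) ⟨
        - (α * combination others (removeAt a t₀) zero) ≈⟨ -‿cong (*-congˡ (sum-zero λ s → trans (*-congˡ (rest≈0 s)) (zeroʳ _))) ⟩
        - (α * 0#)                                   ≈⟨ -‿cong (zeroʳ α) ⟩
        - 0#                                         ≈⟨ -0#≈0# ⟩
        0#                                           ∎

    reduced-dependent⇒ : Dependent reduced → Dependent u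
    reduced-dependent⇒ (b , rel , s , bₛ≉0) =
      lift b , lift-relation b rel , punchIn t₀ s , bₛ≉0 ∘ trans (sym (reflexive (Vector.insertAt-punchIn b t₀ _ s)))

  independent⊎dependent : ∀ {m p} (u : Fin p → Vector Carrier m) → ¬ ¬ (Independent u ⊎ Dependent u)

  independent⊎dependent-pivot : ∀ {m p} (u : Fin (suc p) → Vector Carrier (suc m)) t₀ →
    u t₀ zero ≉ 0# → ¬ ¬ (Independent u ⊎ Dependent u)

  independent⊎dependent {zero}  {zero}  u k = k (inj₁ λ _ _ ())
  independent⊎dependent {zero}  {suc p} u k = k (inj₂ (const 1# , (λ ()) , zero , 1#≉0#))
  independent⊎dependent {suc m} {zero}  u k = k (inj₁ λ _ _ ())
  independent⊎dependent {suc m} {suc p} u k = ¬¬-zero⊎nonzero (λ t → u t zero) λ where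
    (inj₂ (t₀ , pivot≉0)) → independent⊎dependent-pivot u t₀ pivot≉0 k
    (inj₁ heads≈0)        → independent⊎dependent (tail ∘ u) λ where
      (inj₁ ind)               → k (inj₁ λ a rel → ind a (rel ∘ suc))
      (inj₂ (a , rel , t , a≉0)) →
        k (inj₂ (a , zero-head-relation u heads≈0 a rel , t , a≉0))

  independent⊎dependent-pivot u t₀ pivot≉0 k with inverse (u t₀ zero) pivot≉0
  ... | α , pivot⁻¹ = independent⊎dependent reduced λ where
      (inj₁ ind) → k (inj₁ (reduced⇒independent ind))
      (inj₂ dep) → k (inj₂ (reduced-dependent⇒ dep))
    where open Elimination u t₀ pivot⁻¹

  SupportedIn : ∀ {m} → Subset m → Vector Carrier m → Set ℓ
  SupportedIn S v = ∀ i → lookup S i ≡ false → v i ≈ 0#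

  independent-supported-≤ : ∀ {m p} (S : Subset m) (u : Fin p → Vector Carrier m) →
    (∀ t → SupportedIn S (u t)) → Independent u → p ≤ ∣ S ∣
  independent-supported-≤ S u supp ind = ℕ.≮⇒≥ (bound S u supp ind)
    where
    bound : ∀ {m p} (S : Subset m) (u : Fin p → Vector Carrier m) →
      (∀ t → SupportedIn S (u t)) → Independent u → ¬ (∣ S ∣ < p)
    bound-pivot : ∀ {m p} (S : Subset m) (u : Fin (suc p) → Vector Carrier (suc m)) →
      (∀ t → SupportedIn S (tail (u t))) → Independent u → ∀ t₀ → u t₀ zero ≉ 0# → ¬ (∣ S ∣ < p)
    bound {p = suc p} []          u supp ind _ = 1#≉0# (ind (const 1#) (λ ()) zero)
    bound             (false ∷ S) u supp ind =
      bound S (tail ∘ u) (λ t i → supp t (suc i)) λ a → ind a ∘ zero-head-relation u (λ t → supp t zero ≡.refl) a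
    bound {p = suc p} (true ∷ S)  u supp ind (s≤s ∣S∣<p) = ¬¬-zero⊎nonzero (λ t → u t zero) λ where
      (inj₁ heads≈0) → bound S (tail ∘ u) (λ t i → supp t (suc i)) (λ a → ind a ∘ zero-head-relation u heads≈0 a)
        (ℕ.m<n⇒m<1+n ∣S∣<p)
      (inj₂ (t₀ , pivot≉0)) → bound-pivot S u (λ t i → supp t (suc i)) ind t₀ pivot≉0 ∣S∣<p
    bound-pivot S u supp ind t₀ pivot≉0 with inverse (u t₀ zero) pivot≉0
    ... | α , pivot⁻¹ = bound S reduced supp-reduced (independent⇒reduced ind)
      where
      open Elimination u t₀ pivot⁻¹
      supp-reduced : ∀ s → SupportedIn S (reduced s)
      supp-reduced s i i∉S = begin
        others s (suc i) - u t₀ (suc i) * (α * others s zero) ≈⟨ +-cong (supp (punchIn t₀ s) i i∉S) (-‿cong (*-congʳ (supp t₀ i i∉S))) ⟩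
        0# - 0# * (α * others s zero)                         ≈⟨ +-congˡ (-‿cong (zeroˡ _)) ⟩
        0# - 0#                                               ≈⟨ -‿inverseʳ 0# ⟩
        0#                                                    ∎

  diagonal⇒independent : ∀ {q m} (u : Fin q → Vector Carrier m) (e : Fin q → Fin m) →
    (∀ s → u s (e s) ≉ 0#) → (∀ s s₀ → s ≢ s₀ → u s (e s₀) ≈ 0#) → Independent u
  diagonal⇒independent u e diag≉0 off≈0 b rel s₀ = nonzero-cancelˡ (diag≉0 s₀) (begin
    u s₀ (e s₀) * b s₀         ≈⟨ sum-pick (λ s → u s (e s₀) * b s) s₀ (λ s s≢s₀ → trans (*-congʳ (off≈0 s s₀ s≢s₀)) (zeroˡ (b s))) ⟨
    combination u b (e s₀)     ≈⟨ rel (e s₀) ⟩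
    0#                         ∎)

  δ-refl : ∀ {n} (j : Fin n) → δ j j ≈ 1#
  δ-refl j with j Fin.≟ j
  ... | yes _   = refl
  ... | no j≢j = contradiction ≡.refl j≢j

  δ-≢ : ∀ {n} {i j : Fin n} → i ≢ j → δ i j ≈ 0#
  δ-≢ {i = i} {j} i≢j with i Fin.≟ j
  ... | yes i≡j = contradiction i≡j i≢j
  ... | no  _   = refl

  basis : ∀ {n} → Fin n → Vector Carrier n
  basis j k = δ k j

  infixr 7 _·_
  _·_ : ∀ {n} → Matrix n → Vector Carrier n → Vector Carrier n
  (M · x) i = sum (λ k → M i k * x k)

  ·-cong : ∀ {n} (M : Matrix n) {x y : Vector Carrier n} → (∀ k → x k ≈ y k) → ∀ i → (M · x) i ≈ (M · y) i
  ·-cong M x≈y i = sum-cong-≋ λ k → *-congˡ (x≈y k)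

  ·-basis : ∀ {n} (M : Matrix n) j i → (M · basis j) i ≈ M i j
  ·-basis M j i = begin
    (M · basis j) i   ≈⟨ sum-pick (λ k → M i k * δ k j) j (λ k k≢j → trans (*-congˡ (δ-≢ k≢j)) (zeroʳ _)) ⟩
    M i j * δ j j     ≈⟨ trans (*-congˡ (δ-refl j)) (*-identityʳ _) ⟩
    M i j             ∎

  ·-combination : ∀ {n p} (M : Matrix n) (u : Fin p → Vector Carrier n) a i →
    (M · combination u a) i ≈ combination (λ t → M · u t) a i
  ·-combination M u a i = begin
    sum (λ k → M i k * sum (λ t → u t k * a t))     ≈⟨ sum-cong-≋ (λ k → *-distribˡ-sum (M i k) (λ t → u t k * a t)) ⟩
    sum (λ k → sum (λ t → M i k * (u t k * a t)))   ≈⟨ ∑-comm (λ k t → M i k * (u t k * a t)) ⟩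
    sum (λ t → sum (λ k → M i k * (u t k * a t)))   ≈⟨ sum-cong-≋ (λ t → sum-cong-≋ λ k → sym (*-assoc (M i k) _ (a t))) ⟩
    sum (λ t → sum (λ k → M i k * u t k * a t))     ≈⟨ sum-cong-≋ (λ t → sym (*-distribʳ-sum (a t) (λ k → M i k * u t k))) ⟩
    combination (λ t → M · u t) a i                 ∎

  ·-+ : ∀ {n} (M : Matrix n) x y i → (M · (λ k → x k + y k)) i ≈ (M · x) i + (M · y) i
  ·-+ M x y i = trans (sum-cong-≋ λ k → distribˡ (M i k) (x k) (y k)) (∑-distrib-+ (λ k → M i k * x k) (λ k → M i k * y k))

  ·-zero : ∀ {n} (M : Matrix n) {x} → IsZero x → IsZero (M · x)
  ·-zero M x≈0 i = sum-zero λ k → trans (*-congˡ (x≈0 k)) (zeroʳ (M i k))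

  -- Rank and nullity of principal submatrices

  ∈⇒lookup : ∀ {n} {A : Subset n} {i} → i ∈ A → lookup A i ≡ true
  ∈⇒lookup = Vec.[]=⇒lookup

  false⇒≢ : ∀ {n} (A : Subset n) {i j} → lookup A i ≡ false → j ∈ A → i ≢ j
  false⇒≢ A i∉A j∈A ≡.refl = contradiction (≡.trans (≡.sym i∉A) (∈⇒lookup j∈A)) λ ()

  column : ∀ {n} → Matrix n → Subset n → Fin n → Vector Carrier n
  column M A j i = if lookup A i then M i j else 0#

  combination-column-∈ : ∀ {n q} (M : Matrix n) A (ks : Fin q → Fin n) a {i} → lookup A i ≡ true →
    combination (column M A ∘ ks) a i ≈ sum (λ t → M i (ks t) * a t)
  combination-column-∈ M A ks a {i} i∈A rewrite i∈A = refl

  IndependentCols⇒Independent : ∀ {n q} (M : Matrix n) A (ks : Fin q → Fin n) →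
    IndependentCols M A ks → Independent (column M A ∘ ks)
  IndependentCols⇒Independent M A ks ic a rel = ic a λ i i∈A → begin
    sumF (λ t → M i (ks t) * a t)       ≡⟨ sumF≡sum (λ t → M i (ks t) * a t) ⟩
    sum (λ t → M i (ks t) * a t)        ≈⟨ combination-column-∈ M A ks a (∈⇒lookup i∈A) ⟨
    combination (column M A ∘ ks) a i   ≈⟨ rel i ⟩
    0#                                  ∎

  Independent⇒IndependentCols : ∀ {n q} (M : Matrix n) A (ks : Fin q → Fin n) →
    Independent (column M A ∘ ks) → IndependentCols M A ks
  Independent⇒IndependentCols M A ks ind a rel = ind a relation
    where
    relation : IsZero (combination (column M A ∘ ks) a)
    relation i with lookup A i in i∈?A
    ... | true  = trans (reflexive (≡.sym (sumF≡sum (λ t → M i (ks t) * a t)))) (rel i (Vec.lookup⇒[]= i A i∈?A))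
    ... | false = sum-zero λ t → zeroˡ (a t)

  InKernel : ∀ {n} → Matrix n → Subset n → Vector Carrier n → Set ℓ
  InKernel M A x = SupportedIn A x × (∀ i → lookup A i ≡ true → (M · x) i ≈ 0#)

  relation⇒kernel : ∀ {n q} (M : Matrix n) A (ks : Fin q → Fin n) → (∀ t → ks t ∈ A) →
    ∀ a → IsZero (combination (column M A ∘ ks) a) → InKernel M A (combination (basis ∘ ks) a)
  relation⇒kernel M A ks ks∈A a rel = supported , annihilated
    where
    supported : SupportedIn A (combination (basis ∘ ks) a)
    supported i i∉A = sum-zero λ t → trans (*-congʳ (δ-≢ (false⇒≢ A i∉A (ks∈A t)))) (zeroˡ (a t))
    annihilated : ∀ i → lookup A i ≡ true → (M · combination (basis ∘ ks) a) i ≈ 0#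
    annihilated i i∈A = begin
      (M · combination (basis ∘ ks) a) i        ≈⟨ ·-combination M (basis ∘ ks) a i ⟩
      combination (λ t → M · basis (ks t)) a i  ≈⟨ sum-cong-≋ (λ t → *-congʳ (·-basis M (ks t) i)) ⟩
      sum (λ t → M i (ks t) * a t)              ≈⟨ combination-column-∈ M A ks a i∈A ⟨
      combination (column M A ∘ ks) a i         ≈⟨ rel i ⟩
      0#                                        ∎

  KernelFamily : ∀ {n} → Matrix n → Subset n → ℕ → Set (c ⊔ ℓ)
  KernelFamily {n} M A p = Σ[ u ∈ (Fin p → Vector Carrier n) ] (∀ t → InKernel M A (u t)) × Independent u

  kernel++basis-independent : ∀ {n p r} (M : Matrix n) A (u : Fin p → Vector Carrier n) (js : Fin r → Fin n) →
    (∀ t → InKernel M A (u t)) → Independent u → IndependentCols M A js → Independent (u ++ basis ∘ js)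
  kernel++basis-independent {p = p} {r} M A u js inKernel ind ic a rel = IsZero-↑ a aᵘ≈0 aʷ≈0
    where
    w : Fin r → Vector Carrier _
    w = basis ∘ js
    aᵘ : Vector Carrier p
    aᵘ = a ∘ (_↑ˡ r)
    aʷ : Vector Carrier r
    aʷ = a ∘ (p ↑ʳ_)
    split : ∀ i → combination (u ++ w) a i ≈ combination u aᵘ i + combination w aʷ i
    split i = trans (sum-↑ {p} {r} (λ t → (u ++ w) t i * a t)) (+-cong
      (sum-cong-≋ λ t → *-congʳ (reflexive (≡.cong (λ v → v i) (Vector.lookup-++ˡ u w t))))
      (sum-cong-≋ λ s → *-congʳ (reflexive (≡.cong (λ v → v i) (Vector.lookup-++ʳ u w s)))))
    uPart≈0 : ∀ i → lookup A i ≡ true → (M · combination u aᵘ) i ≈ 0#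
    uPart≈0 i i∈A = trans (·-combination M u aᵘ i) (sum-zero λ t → trans (*-congʳ (proj₂ (inKernel t) i i∈A)) (zeroˡ (aᵘ t)))
    aʷ≈0 : IsZero aʷ
    aʷ≈0 = ic aʷ λ i i∈A → begin
      sumF (λ s → M i (js s) * aʷ s)                           ≡⟨ sumF≡sum (λ s → M i (js s) * aʷ s) ⟩
      sum (λ s → M i (js s) * aʷ s)                            ≈⟨ sum-cong-≋ (λ s → *-congʳ (·-basis M (js s) i)) ⟨
      combination (λ s → M · w s) aʷ i                         ≈⟨ ·-combination M w aʷ i ⟨
      (M · combination w aʷ) i                                 ≈⟨ +-identityˡ _ ⟨
      0# + (M · combination w aʷ) i                            ≈⟨ +-congʳ (uPart≈0 i (∈⇒lookup i∈A)) ⟨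
      (M · combination u aᵘ) i + (M · combination w aʷ) i      ≈⟨ ·-+ M (combination u aᵘ) (combination w aʷ) i ⟨
      (M · (λ k → combination u aᵘ k + combination w aʷ k)) i  ≈⟨ ·-zero M (λ k → trans (sym (split k)) (rel k)) i ⟩
      0#                                                       ∎
    aᵘ≈0 : IsZero aᵘ
    aᵘ≈0 = ind aᵘ λ i → begin
      combination u aᵘ i                           ≈⟨ +-identityʳ _ ⟨
      combination u aᵘ i + 0#                      ≈⟨ +-congˡ (sum-zero λ s → trans (*-congˡ (aʷ≈0 s)) (zeroʳ _)) ⟨
      combination u aᵘ i + combination w aʷ i      ≈⟨ split i ⟨
      combination (u ++ w) a i                     ≈⟨ rel i ⟩
      0#                                           ∎

  kernelFamily-≤ : ∀ {n p r} (M : Matrix n) A (js : Fin r → Fin n) → (∀ t → js t ∈ A) →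
    IndependentCols M A js → KernelFamily M A p → p ℕ.+ r ≤ ∣ A ∣
  kernelFamily-≤ {p = p} M A js js∈A ic (u , inKernel , ind) =
    independent-supported-≤ A (u ++ basis ∘ js) supported (kernel++basis-independent M A u js inKernel ind ic)
    where
    supported : ∀ t → SupportedIn A ((u ++ basis ∘ js) t)
    supported t i i∉A with splitAt p t
    ... | inj₁ t′ = proj₁ (inKernel t′) i i∉A
    ... | inj₂ s  = δ-≢ (false⇒≢ A i∉A (js∈A s))

  LeadingRelation : ∀ {n r} → Matrix n → Subset n → (Fin (suc r) → Fin n) → Set (c ⊔ ℓ)
  LeadingRelation {r = r} M A ks = Σ[ a ∈ Vector Carrier (suc r) ] IsZero (combination (column M A ∘ ks) a) × a zero ≉ 0#

  ¬¬-leadingRelation : ∀ {n r} (M : Matrix n) A (ks : Fin (suc r) → Fin n) →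
    IndependentCols M A (tail ks) → ¬ IndependentCols M A ks → ¬ ¬ LeadingRelation M A ks
  ¬¬-leadingRelation M A ks ic ¬ic k = independent⊎dependent (column M A ∘ ks) λ where
    (inj₁ ind)                   → ¬ic (Independent⇒IndependentCols M A ks ind)
    (inj₂ (a , rel , t , aₜ≉0)) → ¬¬-excluded-middle λ where
      (no a₀≉0)  → k (a , rel , a₀≉0)
      (yes a₀≈0) → aₜ≉0 (IsZero-removeAt {a = a} zero a₀≈0
        (IndependentCols⇒Independent M A (tail ks) ic (tail a) λ i → begin
          combination (column M A ∘ tail ks) (tail a) i                ≈⟨ +-identityˡ _ ⟨
          0# + combination (column M A ∘ tail ks) (tail a) i           ≈⟨ +-congʳ (trans (*-congˡ a₀≈0) (zeroʳ _)) ⟨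
          column M A (ks zero) i * a zero + combination (column M A ∘ tail ks) (tail a) i ≈⟨ rel i ⟩
          0#                                                           ∎) t)

  -- Since js avoids e, the family u is diagonal at the coordinates e.
  leading⇒kernelFamily : ∀ {n q r} (M : Matrix n) A (js : Fin r → Fin n) (e : Fin q → Fin n) →
    (∀ s t → (e s Vector.∷ js) t ∈ A) → (∀ s t → js t ≢ e s) → (∀ {s s₀} → e s ≡ e s₀ → s ≡ s₀) →
    (∀ s → LeadingRelation M A (e s Vector.∷ js)) → KernelFamily M A q
  leading⇒kernelFamily M A js e ks∈A js≢e e-injective relations =
    u , (λ s → relation⇒kernel M A (e s Vector.∷ js) (ks∈A s) (a s) (proj₁ (proj₂ (relations s)))) ,
    diagonal⇒independent u e diagonal off-diagonal
    where
    a : ∀ s → Vector Carrier _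
    a s = proj₁ (relations s)
    u : Fin _ → Vector Carrier _
    u s = combination (basis ∘ (e s Vector.∷ js)) (a s)
    u-at-e : ∀ s s₀ → u s (e s₀) ≈ δ (e s₀) (e s) * a s zero
    u-at-e s s₀ = trans (+-congˡ (sum-zero λ t → trans (*-congʳ (δ-≢ (js≢e s₀ t ∘ ≡.sym))) (zeroˡ _))) (+-identityʳ _)
    diagonal : ∀ s → u s (e s) ≉ 0#
    diagonal s u≈0 = proj₂ (proj₂ (relations s))
      (trans (sym (trans (*-congʳ (δ-refl (e s))) (*-identityˡ _))) (trans (sym (u-at-e s s)) u≈0))
    off-diagonal : ∀ s s₀ → s ≢ s₀ → u s (e s₀) ≈ 0#
    off-diagonal s s₀ s≢s₀ = trans (u-at-e s s₀) (trans (*-congʳ (δ-≢ (s≢s₀ ∘ e-injective ∘ ≡.sym))) (zeroˡ _))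

  -- Each column of M[A] outside the r independent ones gives a kernel vector (by maximality).
  ¬¬-kernelFamily : ∀ {n r} (M : Matrix n) A → IsRank M A r →
    ¬ ¬ (Σ[ p ∈ ℕ ] KernelFamily M A p × ∣ A ∣ ≤ p ℕ.+ r)
  ¬¬-kernelFamily {n} {r} M A (((js , js∈A , js-injective) , ic) , maximal) k =
    ¬¬-∀-Fin leading λ relations →
      k (∣ T ∣ , leading⇒kernelFamily M A js e ks∈A js≢e (enum-injective T) relations , size)
    where
    T : Subset n
    T = A ∩ ∁ (image js)
    e : Fin ∣ T ∣ → Fin n
    e = enum T
    js≢e : ∀ s t → js t ≢ e s
    js≢e s t js≡e = x∈∁p⇒x∉p (proj₂ (x∈p∩q⁻ A (∁ (image js)) (enum-∈ T s))) (≡.subst (_∈ image js) js≡e (∈-image js t))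
    ks∈A : ∀ s t → (e s Vector.∷ js) t ∈ A
    ks∈A s zero    = proj₁ (x∈p∩q⁻ A (∁ (image js)) (enum-∈ T s))
    ks∈A s (suc t) = js∈A t
    ks-injective : ∀ s {t t′} → (e s Vector.∷ js) t ≡ (e s Vector.∷ js) t′ → t ≡ t′
    ks-injective s {zero}  {zero}   _  = ≡.refl
    ks-injective s {zero}  {suc t′} eq = contradiction (≡.sym eq) (js≢e s t′)
    ks-injective s {suc t} {zero}   eq = contradiction eq (js≢e s t)
    ks-injective s {suc t} {suc t′} eq = ≡.cong suc (js-injective t t′ eq)
    leading : ∀ s → ¬ ¬ LeadingRelation M A (e s Vector.∷ js)
    leading s = ¬¬-leadingRelation M A (e s Vector.∷ js) ic (maximal (e s Vector.∷ js , ks∈A s , λ t t′ → ks-injective s))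
    size : ∣ A ∣ ≤ ∣ T ∣ ℕ.+ r
    size = ℕ.≤-trans (∣p∣≤∣p∩∁q∣+∣q∣ A (image js)) (ℕ.+-monoʳ-≤ ∣ T ∣ (∣image∣≤ js))

  -- The exchange relation

  merge : ∀ {n} → Subset n → Vector Carrier n → Vector Carrier n → Vector Carrier n
  merge X x y i = if lookup X i then x i else y i

  merge-in : ∀ {n} (X : Subset n) (x y : Vector Carrier n) {i} → lookup X i ≡ true → merge X x y i ≈ x i
  merge-in X x y X∋i rewrite X∋i = refl

  merge-out : ∀ {n} (X : Subset n) (x y : Vector Carrier n) {i} → lookup X i ≡ false → merge X x y i ≈ y i
  merge-out X x y X∌i rewrite X∌i = refl

  by-lookup : ∀ {a n} {A : Set a} (X : Subset n) i → (lookup X i ≡ true → A) → (lookup X i ≡ false → A) → A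
  by-lookup {A = A} X i on-X off-X = cases (lookup X i) ≡.refl
    where
    cases : ∀ b → lookup X i ≡ b → A
    cases true  = on-X
    cases false = off-X

  record Exchanges {n} (M M' : Matrix n) (X : Subset n) : Set (c ⊔ ℓ) where
    field exchange-law : ∀ x i → (M' · merge X (M · x) x) i ≈ merge X x (M · x) i

  open Exchanges

  module _ {n} {M M' : Matrix n} {X : Subset n} (exchanges : Exchanges M M' X) where

    exchange : Vector Carrier n → Vector Carrier n
    exchange x = merge X (M · x) x

    exchange-combination : ∀ {p} (u : Fin p → Vector Carrier n) a i →
      exchange (combination u a) i ≈ combination (exchange ∘ u) a i
    exchange-combination u a i with lookup X i
    ... | true  = ·-combination M u a i
    ... | false = refl

    exchange-zero : ∀ {x} → IsZero (exchange x) → IsZero x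
    exchange-zero {x} x′≈0 i with lookup X i in X∋?i
    ... | false = trans (sym (reflexive (≡.cong (if_then (M · x) i else x i) X∋?i))) (x′≈0 i)
    ... | true  = begin
      x i                          ≈⟨ reflexive (≡.cong (if_then x i else (M · x) i) X∋?i) ⟨
      merge X x (M · x) i          ≈⟨ exchange-law exchanges x i ⟨
      (M' · exchange x) i          ≈⟨ ·-zero M' x′≈0 i ⟩
      0#                           ∎

    exchange-kernel : ∀ {A x} → InKernel M (A Δ X) x → InKernel M' A (exchange x)
    exchange-kernel {A} {x} (supported , annihilated) = supported′ , annihilated′
      where
      lookup-Δ : ∀ {i a b} → lookup A i ≡ a → lookup X i ≡ b → lookup (A Δ X) i ≡ a xor b
      lookup-Δ {i} A∋?i X∋?i = ≡.trans (Vec.lookup-zipWith _xor_ i A X) (≡.cong₂ _xor_ A∋?i X∋?i)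
      supported′ : SupportedIn A (exchange x)
      supported′ i A∌i with lookup X i in X∋?i
      ... | true  = annihilated i (lookup-Δ A∌i X∋?i)
      ... | false = supported i (lookup-Δ A∌i X∋?i)
      annihilated′ : ∀ i → lookup A i ≡ true → (M' · exchange x) i ≈ 0#
      annihilated′ i A∋i = trans (exchange-law exchanges x i) (merge-on-A i A∋i)
        where
        merge-on-A : ∀ i → lookup A i ≡ true → merge X x (M · x) i ≈ 0#
        merge-on-A i A∋i with lookup X i in X∋?i
        ... | true  = supported i (lookup-Δ A∋i X∋?i)
        ... | false = annihilated i (lookup-Δ A∋i X∋?i)

    exchange-kernelFamily : ∀ {A p} → KernelFamily M (A Δ X) p → KernelFamily M' A p
    exchange-kernelFamily {A} (u , inKernel , independent) =
      exchange ∘ u , exchange-kernel {A} ∘ inKernel ,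
      λ a rel → independent a (exchange-zero λ i → trans (exchange-combination u a i) (rel i))

  exchanges-sym : ∀ {n} {M M' : Matrix n} {X : Subset n} → Exchanges M M' X →
    (∀ x i → lookup X i ≡ true → (M · merge X (M' · x) x) i ≈ x i) → Exchanges M' M X
  exchanges-sym {M = M} {M'} {X} exchanges on-X .exchange-law x i with lookup X i in X∋?i
  ... | true  = on-X x i X∋?i
  ... | false = begin
    (M · w) i                          ≈⟨ merge-out X w (M · w) X∋?i ⟨
    merge X w (M · w) i                ≈⟨ exchange-law exchanges w i ⟨
    (M' · merge X (M · w) w) i         ≈⟨ ·-cong M' back i ⟩
    (M' · x) i                         ∎
    where
    w : Vector Carrier _
    w = merge X (M' · x) x
    back : ∀ k → merge X (M · w) w k ≈ x k
    back k with lookup X k in X∋?k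
    ... | true  = on-X x k X∋?k
    ... | false = refl

  ≈⇒exchanges-∅ : ∀ {n} {M M' : Matrix n} → (∀ i j → M' i j ≈ M i j) → Exchanges M M' ∅
  ≈⇒exchanges-∅ {n} {M} {M'} M'≈M .exchange-law x i = begin
    (M' · merge ∅ (M · x) x) i   ≈⟨ ·-cong M' (λ k → merge-out ∅ (M · x) x (Vec.lookup-replicate k false)) i ⟩
    (M' · x) i                   ≈⟨ sum-cong-≋ (λ k → *-congʳ (M'≈M i k)) ⟩
    (M · x) i                    ≈⟨ merge-out ∅ x (M · x) (Vec.lookup-replicate i false) ⟨
    merge ∅ x (M · x) i          ∎

  nullity-≤ : ∀ {n r r'} {M M' : Matrix n} {X A : Subset n} → Exchanges M M' X →
    IsRank M (A Δ X) r → IsRank M' A r' → ∣ A Δ X ∣ ℕ.+ r' ≤ ∣ A ∣ ℕ.+ r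
  nullity-≤ {M = M} {M'} {X} {A} exchanges rank (((js' , js'∈A , _) , ic') , _) =
    decidable-stable (_ ≤? _) λ k → ¬¬-kernelFamily M (A Δ X) rank λ (p , family , ∣A∆X∣≤p+r) →
      k (+-≤-transfer ∣A∆X∣≤p+r (kernelFamily-≤ M' A js' js'∈A ic' (exchange-kernelFamily exchanges {A} family)))

  nullity-Δ : ∀ {n} {M M' : Matrix n} {X : Subset n} {ρ ρ' : Subset n → ℕ} →
    Exchanges M M' X → Exchanges M' M X → RankFunction M ρ → RankFunction M' ρ' →
    ∀ A → ρ' A ℕ.+ ∣ A Δ X ∣ ≡ ρ (A Δ X) ℕ.+ ∣ A ∣
  nullity-Δ {M' = M'} {X} {ρ} {ρ'} exchanges exchanges⁻¹ rank rank' A =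
    ≡.trans (ℕ.+-comm (ρ' A) _) (≡.trans (ℕ.≤-antisym ≤-forward ≤-backward) (ℕ.+-comm ∣ A ∣ (ρ (A Δ X))))
    where
    ≤-forward : ∣ A Δ X ∣ ℕ.+ ρ' A ≤ ∣ A ∣ ℕ.+ ρ (A Δ X)
    ≤-forward = nullity-≤ exchanges (rank (A Δ X)) (rank' A)
    ≤-backward : ∣ A ∣ ℕ.+ ρ (A Δ X) ≤ ∣ A Δ X ∣ ℕ.+ ρ' A
    ≤-backward = ≡.subst (λ B → ∣ B ∣ ℕ.+ ρ (A Δ X) ≤ ∣ A Δ X ∣ ℕ.+ ρ' A) (Δ-involutive A X)
      (nullity-≤ exchanges⁻¹ (≡.subst (λ B → IsRank M' B (ρ' A)) (≡.sym (Δ-involutive A X)) (rank' A)) (rank (A Δ X)))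

  pDeltaCoeff-exchange : ∀ {n} {M M' : Matrix n} {X : Subset n} {ρ ρ' : Subset n → ℕ} →
    Exchanges M M' X → Exchanges M' M X → RankFunction M ρ → RankFunction M' ρ' →
    ∀ k → pDeltaCoeff ρ' k ≡ pDeltaCoeff ρ k
  pDeltaCoeff-exchange {X = X} {ρ} {ρ'} exchanges exchanges⁻¹ rank rank' =
    pDeltaCoeff-Δ ρ ρ' X (nullity-Δ exchanges exchanges⁻¹ rank rank')

  -- The principal pivot transform

  χ : Bool → Carrier
  χ b = if b then 1# else 0#

  ∑⟨_⟩_ : ∀ {n} → (Fin n → Bool) → Vector Carrier n → Carrier
  ∑⟨ S ⟩ f = sum (λ k → χ (S k) * f k)

  sum-if≈∑⟨⟩ : ∀ {n} (S : Fin n → Bool) f → sumF (λ k → if S k then f k else 0#) ≈ ∑⟨ S ⟩ f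
  sum-if≈∑⟨⟩ S f = trans (reflexive (sumF≡sum (λ k → if S k then f k else 0#))) (sum-cong-≋ λ k → if≈χ* (S k) (f k))
    where
    if≈χ* : ∀ b x → (if b then x else 0#) ≈ χ b * x
    if≈χ* true  x = sym (*-identityˡ x)
    if≈χ* false x = sym (zeroˡ x)

  ∑⟨⟩-cong : ∀ {n} (S : Fin n → Bool) {f g : Vector Carrier n} → (∀ k → S k ≡ true → f k ≈ g k) → ∑⟨ S ⟩ f ≈ ∑⟨ S ⟩ g
  ∑⟨⟩-cong S {f} {g} f≈g = sum-cong-≋ λ k → masked k (S k) ≡.refl
    where
    masked : ∀ k b → S k ≡ b → χ b * f k ≈ χ b * g k
    masked k true  Sk = *-congˡ (f≈g k Sk)
    masked k false _  = trans (zeroˡ (f k)) (sym (zeroˡ (g k)))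

  ∑⟨⟩-split : ∀ {n} (S : Fin n → Bool) f → sum f ≈ ∑⟨ S ⟩ f + ∑⟨ not ∘ S ⟩ f
  ∑⟨⟩-split S f = trans (sum-cong-≋ λ k → split (S k) (f k)) (∑-distrib-+ (λ k → χ (S k) * f k) (λ k → χ (not (S k)) * f k))
    where
    split : ∀ b x → x ≈ χ b * x + χ (not b) * x
    split true  x = sym (trans (+-cong (*-identityˡ x) (zeroˡ x)) (+-identityʳ x))
    split false x = sym (trans (+-cong (zeroˡ x) (*-identityˡ x)) (+-identityˡ x))

  ∑⟨⟩-+ : ∀ {n} (S : Fin n → Bool) f g → ∑⟨ S ⟩ (λ k → f k + g k) ≈ ∑⟨ S ⟩ f + ∑⟨ S ⟩ g
  ∑⟨⟩-+ S f g = trans (sum-cong-≋ λ k → distribˡ (χ (S k)) (f k) (g k)) (∑-distrib-+ (λ k → χ (S k) * f k) (λ k → χ (S k) * g k))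

  ∑⟨⟩-neg : ∀ {n} (S : Fin n → Bool) f → ∑⟨ S ⟩ (λ k → - f k) ≈ - ∑⟨ S ⟩ f
  ∑⟨⟩-neg S f = trans (sum-cong-≋ λ k → sym (-‿distribʳ-* (χ (S k)) (f k))) (sum-neg (λ k → χ (S k) * f k))

  ∑⟨⟩-minus : ∀ {n} (S : Fin n → Bool) (f g : Vector Carrier n) → ∑⟨ S ⟩ (λ k → f k - g k) ≈ ∑⟨ S ⟩ f - ∑⟨ S ⟩ g
  ∑⟨⟩-minus S f g = trans (∑⟨⟩-+ S f (λ k → - g k)) (+-congˡ (∑⟨⟩-neg S g))

  ∑⟨⟩-*ˡ : ∀ {n} (S : Fin n → Bool) a f → a * ∑⟨ S ⟩ f ≈ ∑⟨ S ⟩ (λ k → a * f k)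
  ∑⟨⟩-*ˡ S a f = trans (*-distribˡ-sum a (λ k → χ (S k) * f k)) (sum-cong-≋ λ k → x*yz≈y*xz a (χ (S k)) (f k))

  ∑⟨⟩-assoc : ∀ {n} (S S' : Fin n → Bool) (a : Vector Carrier n) (B : Matrix n) (y : Vector Carrier n) →
    ∑⟨ S ⟩ (λ k → a k * ∑⟨ S' ⟩ (λ j → B k j * y j)) ≈ ∑⟨ S' ⟩ (λ j → ∑⟨ S ⟩ (λ k → a k * B k j) * y j)
  ∑⟨⟩-assoc S S' a B y = begin
    sum (λ k → χ (S k) * (a k * ∑⟨ S' ⟩ (λ j → B k j * y j)))
      ≈⟨ sum-cong-≋ (λ k → *-congˡ (∑⟨⟩-*ˡ S' (a k) (λ j → B k j * y j))) ⟩
    sum (λ k → χ (S k) * ∑⟨ S' ⟩ (λ j → a k * (B k j * y j)))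
      ≈⟨ sum-cong-≋ (λ k → ∑⟨⟩-*ˡ S' (χ (S k)) (λ j → a k * (B k j * y j))) ⟩
    sum (λ k → sum (λ j → χ (S' j) * (χ (S k) * (a k * (B k j * y j)))))
      ≈⟨ ∑-comm (λ k j → χ (S' j) * (χ (S k) * (a k * (B k j * y j)))) ⟩
    sum (λ j → sum (λ k → χ (S' j) * (χ (S k) * (a k * (B k j * y j)))))
      ≈⟨ sum-cong-≋ (λ j → sum-cong-≋ λ k → *-congˡ (regroup (χ (S k)) (a k) (B k j) (y j))) ⟩
    sum (λ j → sum (λ k → χ (S' j) * (χ (S k) * (a k * B k j) * y j)))
      ≈⟨ sum-cong-≋ (λ j → trans (sym (*-distribˡ-sum (χ (S' j)) (λ k → χ (S k) * (a k * B k j) * y j))) (*-congˡ (sym (*-distribʳ-sum (y j) (λ k → χ (S k) * (a k * B k j)))))) ⟩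
    sum (λ j → χ (S' j) * (∑⟨ S ⟩ (λ k → a k * B k j) * y j)) ∎
    where
    regroup : ∀ c a b y → c * (a * (b * y)) ≈ c * (a * b) * y
    regroup c a b y = trans (*-congˡ (sym (*-assoc a b y))) (sym (*-assoc c (a * b) y))

  ∑⟨⟩-δ : ∀ {n} (S : Fin n → Bool) {i} → S i ≡ true → ∀ (d f : Vector Carrier n) →
    (∀ l → S l ≡ true → d l ≈ δ i l) → ∑⟨ S ⟩ (λ l → d l * f l) ≈ f i
  ∑⟨⟩-δ S {i} Si d f d≈δ = begin
    ∑⟨ S ⟩ (λ l → d l * f l)       ≈⟨ ∑⟨⟩-cong S (λ l Sl → *-congʳ (d≈δ l Sl)) ⟩
    ∑⟨ S ⟩ (λ l → δ i l * f l)     ≈⟨ sum-pick (λ l → χ (S l) * (δ i l * f l)) i (λ l l≢i → trans (*-congˡ (trans (*-congʳ (δ-≢ (l≢i ∘ ≡.sym))) (zeroˡ _))) (zeroʳ _)) ⟩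
    χ (S i) * (δ i i * f i)        ≈⟨ *-cong (reflexive (≡.cong χ Si)) (trans (*-congʳ (δ-refl i)) (*-identityˡ _)) ⟩
    1# * f i                       ≈⟨ *-identityˡ (f i) ⟩
    f i                            ∎

  infixr 7 _·⟨_⟩_
  _·⟨_⟩_ : ∀ {n} → Matrix n → (Fin n → Bool) → Vector Carrier n → Vector Carrier n
  (A ·⟨ S ⟩ y) i = ∑⟨ S ⟩ (λ j → A i j * y j)

  infixl 8 _⋆⟨_⟩_
  _⋆⟨_⟩_ : ∀ {n} → Matrix n → (Fin n → Bool) → Matrix n → Matrix n
  (A ⋆⟨ S ⟩ B) i j = ∑⟨ S ⟩ (λ k → A i k * B k j)

  ·⟨⟩-assoc : ∀ {n} (A B : Matrix n) S S' y i → (A ·⟨ S ⟩ (B ·⟨ S' ⟩ y)) i ≈ (A ⋆⟨ S ⟩ B ·⟨ S' ⟩ y) i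
  ·⟨⟩-assoc A B S S' y i = ∑⟨⟩-assoc S S' (A i) B y

  ·⟨⟩-minus : ∀ {n} (A : Matrix n) S (y z : Vector Carrier n) i →
    (A ·⟨ S ⟩ (λ k → y k - z k)) i ≈ (A ·⟨ S ⟩ y) i - (A ·⟨ S ⟩ z) i
  ·⟨⟩-minus A S y z i =
    trans (∑⟨⟩-cong S λ k _ → x[y-z]≈xy-xz (A i k) (y k) (z k)) (∑⟨⟩-minus S (λ k → A i k * y k) (λ k → A i k * z k))

  module Pivot {n} (M N : Matrix n) (X : Subset n) (inverseOn : IsInverseOn M X N) where

    in? out? : Fin n → Bool
    in? = lookup X
    out? k = not (lookup X k)

    M*X : Matrix n
    M*X = pivot M X N

    -- Writing P = M[X] and Q, R, S for the other blocks, as in pivot, these are P⁻¹Q, RP⁻¹ and RP⁻¹Q.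
    NM MN MNM : Matrix n
    NM  = N ⋆⟨ in? ⟩ M
    MN  = M ⋆⟨ in? ⟩ N
    MNM = M ⋆⟨ in? ⟩ NM

    NM≈δ : ∀ {i j} → in? i ≡ true → in? j ≡ true → NM i j ≈ δ i j
    NM≈δ {i} {j} X∋i X∋j = trans (sym (sum-if≈∑⟨⟩ in? (λ k → N i k * M k j)))
                                  (proj₁ (inverseOn i j (Vec.lookup⇒[]= i X X∋i) (Vec.lookup⇒[]= j X X∋j)))

    MN≈δ : ∀ {i j} → in? i ≡ true → in? j ≡ true → MN i j ≈ δ i j
    MN≈δ {i} {j} X∋i X∋j = trans (sym (sum-if≈∑⟨⟩ in? (λ k → M i k * N k j)))
                                  (proj₂ (inverseOn i j (Vec.lookup⇒[]= i X X∋i) (Vec.lookup⇒[]= j X X∋j)))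

    out⇒false : ∀ {j} → out? j ≡ true → in? j ≡ false
    out⇒false = not-injective

    pivot-in-in : ∀ {i j} → in? i ≡ true → in? j ≡ true → M*X i j ≈ N i j
    pivot-in-in X∋i X∋j rewrite X∋i | X∋j = refl

    pivot-in-out : ∀ {i j} → in? i ≡ true → in? j ≡ false → M*X i j ≈ - NM i j
    pivot-in-out {i} {j} X∋i X∌j rewrite X∋i | X∌j = -‿cong (sum-if≈∑⟨⟩ in? (λ k → N i k * M k j))

    pivot-out-in : ∀ {i j} → in? i ≡ false → in? j ≡ true → M*X i j ≈ MN i j
    pivot-out-in {i} {j} X∌i X∋j rewrite X∌i | X∋j = sum-if≈∑⟨⟩ in? (λ k → M i k * N k j)

    pivot-out-out : ∀ {i j} → in? i ≡ false → in? j ≡ false → M*X i j ≈ M i j - MNM i j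
    pivot-out-out {i} {j} X∌i X∌j rewrite X∌i | X∌j = +-congˡ (-‿cong (trans
      (sum-if≈∑⟨⟩ in? (λ k → M i k * sumOver X (λ l → N k l * M l j)))
      (∑⟨⟩-cong in? λ k _ → *-congˡ (sum-if≈∑⟨⟩ in? (λ l → N k l * M l j)))))

    row-in : ∀ y {i} → in? i ≡ true → (M*X · y) i ≈ (N ·⟨ in? ⟩ y) i - (NM ·⟨ out? ⟩ y) i
    row-in y {i} X∋i = begin
      (M*X · y) i
        ≈⟨ ∑⟨⟩-split in? (λ j → M*X i j * y j) ⟩
      ∑⟨ in? ⟩ (λ j → M*X i j * y j) + ∑⟨ out? ⟩ (λ j → M*X i j * y j)
        ≈⟨ +-cong (∑⟨⟩-cong in? λ j X∋j → *-congʳ (pivot-in-in X∋i X∋j))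
                  (∑⟨⟩-cong out? λ j X∌j → trans (*-congʳ (pivot-in-out X∋i (out⇒false X∌j))) (sym (-‿distribˡ-* _ (y j)))) ⟩
      (N ·⟨ in? ⟩ y) i + ∑⟨ out? ⟩ (λ j → - (NM i j * y j))
        ≈⟨ +-congˡ (∑⟨⟩-neg out? (λ j → NM i j * y j)) ⟩
      (N ·⟨ in? ⟩ y) i - (NM ·⟨ out? ⟩ y) i ∎

    row-out : ∀ y {i} → in? i ≡ false → (M*X · y) i ≈ (MN ·⟨ in? ⟩ y) i + ((M ·⟨ out? ⟩ y) i - (MNM ·⟨ out? ⟩ y) i)
    row-out y {i} X∌i = begin
      (M*X · y) i
        ≈⟨ ∑⟨⟩-split in? (λ j → M*X i j * y j) ⟩
      ∑⟨ in? ⟩ (λ j → M*X i j * y j) + ∑⟨ out? ⟩ (λ j → M*X i j * y j)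
        ≈⟨ +-cong (∑⟨⟩-cong in? λ j X∋j → *-congʳ (pivot-out-in X∌i X∋j))
                  (∑⟨⟩-cong out? λ j X∌j → *-congʳ (pivot-out-out X∌i (out⇒false X∌j))) ⟩
      (MN ·⟨ in? ⟩ y) i + ((λ i j → M i j - MNM i j) ·⟨ out? ⟩ y) i
        ≈⟨ +-congˡ (trans (∑⟨⟩-cong out? λ j _ → [y-z]x≈yx-zx (y j) (M i j) (MNM i j))
                          (∑⟨⟩-minus out? (λ j → M i j * y j) (λ j → MNM i j * y j))) ⟩
      (MN ·⟨ in? ⟩ y) i + ((M ·⟨ out? ⟩ y) i - (MNM ·⟨ out? ⟩ y) i) ∎

    ·⟨⟩-δ : ∀ (A : Matrix n) y {i} → in? i ≡ true → (∀ {j} → in? j ≡ true → A i j ≈ δ i j) → (A ·⟨ in? ⟩ y) i ≈ y i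
    ·⟨⟩-δ A y X∋i A≈δ = ∑⟨⟩-δ in? X∋i (A _) y λ j X∋j → A≈δ X∋j

    N·M : ∀ x {i} → in? i ≡ true → (N ·⟨ in? ⟩ (M · x)) i ≈ x i + (NM ·⟨ out? ⟩ x) i
    N·M x {i} X∋i = begin
      (N ·⟨ in? ⟩ (M · x)) i
        ≈⟨ ∑⟨⟩-cong in? (λ l _ → *-congˡ (∑⟨⟩-split in? (λ j → M l j * x j))) ⟩
      (N ·⟨ in? ⟩ (λ l → (M ·⟨ in? ⟩ x) l + (M ·⟨ out? ⟩ x) l)) i
        ≈⟨ trans (∑⟨⟩-cong in? λ l _ → distribˡ (N i l) _ _) (∑⟨⟩-+ in? _ _) ⟩
      (N ·⟨ in? ⟩ (M ·⟨ in? ⟩ x)) i + (N ·⟨ in? ⟩ (M ·⟨ out? ⟩ x)) i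
        ≈⟨ +-cong (·⟨⟩-assoc N M in? in? x i) (·⟨⟩-assoc N M in? out? x i) ⟩
      (NM ·⟨ in? ⟩ x) i + (NM ·⟨ out? ⟩ x) i
        ≈⟨ +-congʳ (·⟨⟩-δ NM x X∋i (NM≈δ X∋i)) ⟩
      x i + (NM ·⟨ out? ⟩ x) i ∎

    M·pivot : ∀ y i → (M ·⟨ in? ⟩ (M*X · y)) i ≈ (MN ·⟨ in? ⟩ y) i - (MNM ·⟨ out? ⟩ y) i
    M·pivot y i = begin
      (M ·⟨ in? ⟩ (M*X · y)) i
        ≈⟨ ∑⟨⟩-cong in? (λ k X∋k → *-congˡ (row-in y X∋k)) ⟩
      (M ·⟨ in? ⟩ (λ k → (N ·⟨ in? ⟩ y) k - (NM ·⟨ out? ⟩ y) k)) i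
        ≈⟨ ·⟨⟩-minus M in? (N ·⟨ in? ⟩ y) (NM ·⟨ out? ⟩ y) i ⟩
      (M ·⟨ in? ⟩ (N ·⟨ in? ⟩ y)) i - (M ·⟨ in? ⟩ (NM ·⟨ out? ⟩ y)) i
        ≈⟨ +-cong (·⟨⟩-assoc M N in? in? y i) (-‿cong (·⟨⟩-assoc M NM in? out? y i)) ⟩
      (MN ·⟨ in? ⟩ y) i - (MNM ·⟨ out? ⟩ y) i ∎

    MNM≈M : ∀ {i} → in? i ≡ true → ∀ j → MNM i j ≈ M i j
    MNM≈M X∋i j = trans (·⟨⟩-assoc M N in? in? (λ l → M l j) _) (·⟨⟩-δ MN (λ l → M l j) X∋i (MN≈δ X∋i))

    row-out′ : ∀ y {i} → in? i ≡ false → (M*X · y) i ≈ (M ·⟨ in? ⟩ (M*X · y)) i + (M ·⟨ out? ⟩ y) i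
    row-out′ y {i} X∌i = begin
      (M*X · y) i                                                         ≈⟨ row-out y X∌i ⟩
      (MN ·⟨ in? ⟩ y) i + ((M ·⟨ out? ⟩ y) i - (MNM ·⟨ out? ⟩ y) i)    ≈⟨ x+yz≈xz+y _ _ _ ⟩
      ((MN ·⟨ in? ⟩ y) i - (MNM ·⟨ out? ⟩ y) i) + (M ·⟨ out? ⟩ y) i    ≈⟨ +-congʳ (M·pivot y i) ⟨
      (M ·⟨ in? ⟩ (M*X · y)) i + (M ·⟨ out? ⟩ y) i                        ∎

    exchange-on-X : ∀ x {i} → in? i ≡ true → (M*X · merge X (M · x) x) i ≈ x i
    exchange-on-X x {i} X∋i = begin
      (M*X · merge X (M · x) x) i                                               ≈⟨ row-in _ X∋i ⟩
      (N ·⟨ in? ⟩ merge X (M · x) x) i - (NM ·⟨ out? ⟩ merge X (M · x) x) i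
        ≈⟨ +-cong (∑⟨⟩-cong in? λ j X∋j → *-congˡ (merge-in X (M · x) x X∋j))
                  (-‿cong (∑⟨⟩-cong out? λ j X∌j → *-congˡ (merge-out X (M · x) x (out⇒false X∌j)))) ⟩
      (N ·⟨ in? ⟩ (M · x)) i - (NM ·⟨ out? ⟩ x) i                           ≈⟨ +-congʳ (N·M x X∋i) ⟩
      x i + (NM ·⟨ out? ⟩ x) i - (NM ·⟨ out? ⟩ x) i                         ≈⟨ +-assoc _ _ _ ⟩
      x i + ((NM ·⟨ out? ⟩ x) i - (NM ·⟨ out? ⟩ x) i)                       ≈⟨ +-congˡ (-‿inverseʳ _) ⟩
      x i + 0#                                                               ≈⟨ +-identityʳ (x i) ⟩
      x i                                                                    ∎

    exchange-off-X : ∀ x {i} → in? i ≡ false → (M*X · merge X (M · x) x) i ≈ (M · x) i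
    exchange-off-X x {i} X∌i = begin
      (M*X · merge X (M · x) x) i                                               ≈⟨ row-out′ _ X∌i ⟩
      (M ·⟨ in? ⟩ (M*X · merge X (M · x) x)) i + (M ·⟨ out? ⟩ merge X (M · x) x) i
        ≈⟨ +-cong (∑⟨⟩-cong in? λ j X∋j → *-congˡ (exchange-on-X x X∋j))
                  (∑⟨⟩-cong out? λ j X∌j → *-congˡ (merge-out X (M · x) x (out⇒false X∌j))) ⟩
      (M ·⟨ in? ⟩ x) i + (M ·⟨ out? ⟩ x) i                                   ≈⟨ ∑⟨⟩-split in? (λ j → M i j * x j) ⟨
      (M · x) i                                                              ∎

    exchanges : Exchanges M M*X X
    exchanges .exchange-law x i = by-lookup X i
      (λ X∋i → trans (exchange-on-X x X∋i) (sym (merge-in X x (M · x) X∋i)))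
      (λ X∌i → trans (exchange-off-X x X∌i) (sym (merge-out X x (M · x) X∌i)))

    exchanges⁻¹ : Exchanges M*X M X
    exchanges⁻¹ = exchanges-sym exchanges λ x i X∋i → begin
      (M · merge X (M*X · x) x) i
        ≈⟨ ∑⟨⟩-split in? (λ j → M i j * merge X (M*X · x) x j) ⟩
      (M ·⟨ in? ⟩ merge X (M*X · x) x) i + (M ·⟨ out? ⟩ merge X (M*X · x) x) i
        ≈⟨ +-cong (∑⟨⟩-cong in? λ j X∋j → *-congˡ (merge-in X (M*X · x) x X∋j))
                  (∑⟨⟩-cong out? λ j X∌j → *-congˡ (merge-out X (M*X · x) x (out⇒false X∌j))) ⟩
      (M ·⟨ in? ⟩ (M*X · x)) i + (M ·⟨ out? ⟩ x) i
        ≈⟨ +-congʳ (M·pivot x i) ⟩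
      (MN ·⟨ in? ⟩ x) i - (MNM ·⟨ out? ⟩ x) i + (M ·⟨ out? ⟩ x) i
        ≈⟨ +-congʳ (+-cong (·⟨⟩-δ MN x X∋i (MN≈δ X∋i)) (-‿cong (∑⟨⟩-cong out? λ j _ → *-congʳ (MNM≈M X∋i j)))) ⟩
      x i - (M ·⟨ out? ⟩ x) i + (M ·⟨ out? ⟩ x) i
        ≈⟨ trans (+-assoc _ _ _) (trans (+-congˡ (-‿inverseˡ _)) (+-identityʳ (x i))) ⟩
      x i ∎

  pivot-⊤ : ∀ {n} (M N : Matrix n) i j → pivot M ⊤ N i j ≈ N i j
  pivot-⊤ {n} M N i j rewrite Vec.lookup-replicate {n = n} i true | Vec.lookup-replicate {n = n} j true = refl

  inverse⇒inverseOn-⊤ : ∀ {n} {M N : Matrix n} → IsInverse M N → IsInverseOn M ⊤ N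
  inverse⇒inverseOn-⊤ {n} {M} {N} inverse i j _ _ =
    trans (sumOver-⊤ (λ k → N i k * M k j)) (proj₁ (inverse i j)) ,
    trans (sumOver-⊤ (λ k → M i k * N k j)) (proj₂ (inverse i j))
    where
    sumOver-⊤ : ∀ (f : Vector Carrier n) → sumOver ⊤ f ≈ sumF f
    sumOver-⊤ f = begin
      sumF (λ k → if lookup ⊤ k then f k else 0#)   ≡⟨ sumF≡sum (λ k → if lookup ⊤ k then f k else 0#) ⟩
      sum (λ k → if lookup ⊤ k then f k else 0#)    ≈⟨ sum-cong-≋ (λ k → reflexive (≡.cong (if_then f k else 0#) (Vec.lookup-replicate k true))) ⟩
      sum f                                         ≡⟨ sumF≡sum f ⟨
      sumF f                                        ∎

theorem5p2 : ∀ {c ℓ : Level} (𝔽 : Field c ℓ) (n : ℕ) (M : MatrixDefs.Matrix 𝔽 n) →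
    (∀ (X : Subset n) (N : MatrixDefs.Matrix 𝔽 n) → MatrixDefs.IsInverseOn 𝔽 M X N →
      ∀ (ρ ρ' : Subset n → ℕ) →
      MatrixDefs.RankFunction 𝔽 M ρ →
      MatrixDefs.RankFunction 𝔽 (MatrixDefs.pivot 𝔽 M X N) ρ' →
      ∀ k → pDeltaCoeff ρ k ≡ pDeltaCoeff ρ' k)
    × (∀ (N : MatrixDefs.Matrix 𝔽 n) → MatrixDefs.IsInverse 𝔽 M N →
      ∀ (ρ ρ₁ ρ' : Subset n → ℕ) →
      MatrixDefs.RankFunction 𝔽 M ρ →
      MatrixDefs.RankFunction 𝔽 (MatrixDefs.pivot 𝔽 M ⊤ N) ρ₁ →
      MatrixDefs.RankFunction 𝔽 N ρ' →
      (∀ k → pDeltaCoeff ρ k ≡ pDeltaCoeff ρ₁ k) × (∀ k → pDeltaCoeff ρ₁ k ≡ pDeltaCoeff ρ' k))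
theorem5p2 𝔽 n M = pivot-invariant , inverse-invariant
  where
  open Field 𝔽 using (sym)
  open MatrixDefs 𝔽
  open LinearAlgebra 𝔽
  pivot-invariant : ∀ X N → IsInverseOn M X N → ∀ ρ ρ' → RankFunction M ρ → RankFunction (pivot M X N) ρ' →
    ∀ k → pDeltaCoeff ρ k ≡ pDeltaCoeff ρ' k
  pivot-invariant X N inverseOn ρ ρ' rank rank' k = ≡.sym (pDeltaCoeff-exchange exchanges exchanges⁻¹ rank rank' k)
    where open Pivot M N X inverseOn
  inverse-invariant : ∀ N → IsInverse M N → ∀ ρ ρ₁ ρ' →
    RankFunction M ρ → RankFunction (pivot M ⊤ N) ρ₁ → RankFunction N ρ' →
    (∀ k → pDeltaCoeff ρ k ≡ pDeltaCoeff ρ₁ k) × (∀ k → pDeltaCoeff ρ₁ k ≡ pDeltaCoeff ρ' k)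
  inverse-invariant N inverse ρ ρ₁ ρ' rank rank₁ rank' =
    pivot-invariant ⊤ N (inverse⇒inverseOn-⊤ inverse) ρ ρ₁ rank rank₁ ,
    pDeltaCoeff-exchange (≈⇒exchanges-∅ (pivot-⊤ M N)) (≈⇒exchanges-∅ λ i j → sym (pivot-⊤ M N i j)) rank' rank₁
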